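{- For every $n\ge0$, the number of self-describing sequences of length $n+1$ in $\mathcal{A}$ (equivalently, $|\mathcal{C}_n|$) equals the Catalan number $c_{n+1}$. Moreover, for $r=0,\dots,n$, the number of sequences in $\mathcal{C}_n$ whose last term is $r$ equals $c_r c_{n-r}$.
   Context: $\mathcal{A}$ is the set of finite integer sequences $a=(a_0,\dots,a_n)$ with $0\le a_i\le i$ for all $i$. A sequence $a\in\mathcal{A}$ is self-describing if for every index $i$, $a_i=\#\{j: j<i,\ a_j<a_i\}$. The Catalan family $\mathcal{C}=\bigcup_n\mathcal{C}_n$: $\mathcal{C}_0=\{(0)\}$; for $a=(a_0,\dots,a_n)\in\mathcal{C}_n$ let $S(a)=\{x : (a_0,\dots,a_{n-1},x)\in\mathcal{C}_n\}$ (with $S((0))=\{0\}$); then $\mathcal{C}_{n+1}$ consists of all $(a_0,\dots,a_n,y)$ with $a\in\mathcal{C}_n$ and $y\in\{s\in S(a): s\le a_n\}\cup\{n+1\}$. The Catalan numbers are $c_m=\frac{1}{m+1}\binom{2m}{m}$. -}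

module Defs where

open import Data.Nat using (ℕ; zero; suc; _+_; _*_; _∸_; _≤_; _<_; _/_)
import Data.Nat as ℕ
open import Data.Nat.Combinatorics using (_C_)
open import Data.Fin as Fin using (Fin; toℕ)
open import Data.Vec using (Vec; []; _∷_; _∷ʳ_; lookup)
open import Data.List using (List; length; filter)
open import Data.List.Base using (allFin)
open import Data.List.Membership.Propositional using (_∈_)
open import Data.List.Relation.Unary.Unique.Propositional using (Unique)
open import Data.Product using (Σ; _×_)
open import Relation.Nullary.Decidable using (_×-dec_)
open import Relation.Binary.PropositionalEquality using (_≡_)
open import Function.Bundles using (_⇔_)

catalan : ℕ → ℕ
catalan m = ((2 * m) C m) / suc m

InA : ∀ {n} → Vec ℕ (suc n) → Set
InA {n} a = (i : Fin (suc n)) → lookup a i ≤ toℕ i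

countBelow : ∀ {n} → Vec ℕ (suc n) → Fin (suc n) → ℕ
countBelow {n} a i =
  length (filter (λ j → (j Fin.<? i) ×-dec (lookup a j ℕ.<? lookup a i)) (allFin (suc n)))

SelfDescribing : ∀ {n} → Vec ℕ (suc n) → Set
SelfDescribing {n} a = (i : Fin (suc n)) → lookup a i ≡ countBelow a i

-- The Catalan family: CatC n a  means  a ∈ 𝒞_n  (a has length n+1).
-- A sequence in 𝒞_n is written  xs ∷ʳ x  (xs of length n, last term x = a_n);
-- y ∈ S(a)  means  xs ∷ʳ y ∈ 𝒞_n.
data CatC : (n : ℕ) → Vec ℕ (suc n) → Set where
  base : CatC 0 (0 ∷ [])
  new  : ∀ {n} {xs : Vec ℕ n} {x : ℕ} →
         CatC n (xs ∷ʳ x) → CatC (suc n) ((xs ∷ʳ x) ∷ʳ suc n)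
  old  : ∀ {n} {xs : Vec ℕ n} {x y : ℕ} →
         CatC n (xs ∷ʳ x) → CatC n (xs ∷ʳ y) → y ≤ x →
         CatC (suc n) ((xs ∷ʳ x) ∷ʳ y)

HasCard : {A : Set} → (A → Set) → ℕ → Set
HasCard {A} P k =
  Σ (List A) λ L → Unique L × ((x : A) → (x ∈ L) ⇔ P x) × length L ≡ k

{-# OPTIONS --safe #-}

-- Call a sequence nested if a_i ≤ i and a_j ≥ a_i whenever a_i ≤ j ≤ i, i.e. the intervals
-- [a_i, i] are pairwise nested or disjoint.  In a nested sequence the a_i positions before a_i
-- carry smaller values (a_k ≤ k < a_i) and the positions in [a_i, i) do not, so it is
-- self-describing; conversely self-description forces a_i ≤ i and then exactly this shape.  The
-- rule generating 𝒞 is precisely the condition for extending a nested sequence by one term.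
-- A nested sequence of length n+1 with last term r consists of a nested sequence p of length r
-- followed by a nested sequence q of length n−r with a 0 appended, all shifted up by r; so there
-- are c_r c_(n−r) of them, and summing over r gives Segner's recurrence, which (2m choose m)/(m+1)
-- satisfies by the ballot-number form of the reflection principle.

module Submission where

open import Defs
open import Data.Empty using (⊥-elim)
open import Data.Fin as Fin using (Fin; toℕ; fromℕ<)
open import Data.Fin.Properties using (toℕ<n; toℕ-fromℕ<)
open import Data.List as List
  using (List; []; _∷_; _++_; _∷ʳ_; [_]; map; length; take; drop; filter; tabulate; cartesianProduct; initLast; _∷ʳ′_)
open import Data.List.Properties
  using (∷-injective; length-++; length-map; map-++; ++-assoc; ∷ʳ-injective; map-injective; map-∘; map-id-local;
         take++drop≡id; length-take; length-drop)
open import Data.List.Membership.Propositional using (_∈_)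
open import Data.List.Membership.Propositional.Properties
  using (∈-map⁺; ∈-map⁻; ∈-++⁺ˡ; ∈-++⁺ʳ; ∈-++⁻; ∈-cartesianProduct⁺; ∈-cartesianProduct⁻)
open import Data.List.Relation.Unary.All as All using (All; []; _∷_)
import Data.List.Relation.Unary.All.Properties as All
open import Data.List.Relation.Unary.AllPairs using ([]; _∷_)
open import Data.List.Relation.Unary.Any using (here; there)
open import Data.List.Relation.Unary.Unique.Propositional using (Unique)
import Data.List.Relation.Unary.Unique.Propositional.Properties as Unique
open import Data.Nat using (ℕ; zero; suc; _+_; _*_; _∸_; _≤_; _<_; z≤n; s≤s; z<s; s<s)
open import Data.Nat.Combinatorics using (_C_; nC1≡n; nCk≡nC[n∸k]; nCk+nC[k+1]≡[n+1]C[k+1])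
open import Data.Nat.DivMod using (_/_; m*n/n≡m)
open import Data.Nat.Induction using (<-rec)
open import Data.Nat.Properties
open import Algebra.Properties.CommutativeSemigroup +-commutativeSemigroup using (interchange)
open import Data.Nat.Tactic.RingSolver using (solve-∀)
open import Data.Product using (∃-syntax; _×_; _,_; proj₁; proj₂; uncurry)
open import Data.Product.Function.NonDependent.Propositional using (_×-⇔_)
open import Data.Sum as Sum using (_⊎_; inj₁; inj₂)
open import Data.Vec as Vec using (Vec; toList; lookup; last) renaming (_∷ʳ_ to _∷ʳᵛ_)
open import Data.Vec.Properties using (length-toList; toList-∷ʳ)
open import Function.Base using (id; _∘_)
open import Function.Bundles using (_⇔_; mk⇔; Equivalence)
open import Relation.Binary.PropositionalEquality hiding ([_])
open import Relation.Nullary using (Dec; yes; no; ¬_; contradiction)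
open import Relation.Nullary.Decidable using (_×-dec_)
open import Relation.Unary using (Decidable)

open Equivalence
open ≡-Reasoning

private
  variable
    A B : Set
    P Q : A → Set
    k m : ℕ

∑< : ℕ → (ℕ → ℕ) → ℕ
∑< zero    f = 0
∑< (suc n) f = ∑< n f + f n

infix 5 ∑<
syntax ∑< n (λ i → e) = ∑[ i < n ] e

∑-cong : ∀ n {f g : ℕ → ℕ} → (∀ {i} → i < n → f i ≡ g i) → ∑< n f ≡ ∑< n g
∑-cong zero    f≡g = refl
∑-cong (suc n) f≡g = cong₂ _+_ (∑-cong n (λ i<n → f≡g (m<n⇒m<1+n i<n))) (f≡g ≤-refl)

∑-+ : ∀ n (f g : ℕ → ℕ) → ∑[ i < n ] (f i + g i) ≡ ∑< n f + ∑< n g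
∑-+ zero    f g = refl
∑-+ (suc n) f g = trans (cong (_+ (f n + g n)) (∑-+ n f g)) (interchange (∑< n f) (∑< n g) (f n) (g n))

∑-split : ∀ m n (f : ℕ → ℕ) → ∑< (m + n) f ≡ ∑< m f + (∑[ i < n ] f (m + i))
∑-split m zero    f = trans (cong (λ k → ∑< k f) (+-identityʳ m)) (sym (+-identityʳ _))
∑-split m (suc n) f = begin
  ∑< (m + suc n) f                                  ≡⟨ cong (λ k → ∑< k f) (+-suc m n) ⟩
  ∑< (m + n) f + f (m + n)                          ≡⟨ cong (_+ f (m + n)) (∑-split m n f) ⟩
  ∑< m f + (∑[ i < n ] f (m + i)) + f (m + n)       ≡⟨ +-assoc (∑< m f) _ _ ⟩
  ∑< m f + (∑[ i < suc n ] f (m + i))               ∎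

∑-const : ∀ n c → ∑[ i < n ] c ≡ n * c
∑-const zero    c = refl
∑-const (suc n) c = trans (cong (_+ c) (∑-const n c)) (+-comm (n * c) c)

∑-zero : ∀ n {f : ℕ → ℕ} → (∀ {i} → i < n → f i ≡ 0) → ∑< n f ≡ 0
∑-zero n f≡0 = trans (∑-cong n f≡0) (trans (∑-const n 0) (*-zeroʳ n))

∑-mono-≤ : ∀ n {f g : ℕ → ℕ} → (∀ {i} → i < n → f i ≤ g i) → ∑< n f ≤ ∑< n g
∑-mono-≤ zero    f≤g = ≤-refl
∑-mono-≤ (suc n) f≤g = +-mono-≤ (∑-mono-≤ n (λ i<n → f≤g (m<n⇒m<1+n i<n))) (f≤g ≤-refl)

∑≡0⇒≡0 : ∀ n {f : ℕ → ℕ} → ∑< n f ≡ 0 → ∀ {i} → i < n → f i ≡ 0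
∑≡0⇒≡0 (suc n) {f} sum≡0 i<1+n with m<1+n⇒m<n∨m≡n i<1+n
... | inj₁ i<n  = ∑≡0⇒≡0 n (m+n≡0⇒m≡0 (∑< n f) sum≡0) i<n
... | inj₂ refl = m+n≡0⇒n≡0 (∑< n f) sum≡0

∑-convolution-suc : ∀ m (f : ℕ → ℕ → ℕ) →
  ∑[ i < suc (suc m) ] f i (suc m ∸ i) ≡ (∑[ i < suc m ] f i (suc (m ∸ i))) + f (suc m) 0
∑-convolution-suc m f =
  cong₂ _+_ (∑-cong (suc m) (λ i≤m → cong (f _) (+-∸-assoc 1 (m<1+n⇒m≤n i≤m))))
            (cong (f (suc m)) (n∸n≡0 m))

-- Ballot numbers and the Catalan recurrence

-- ballot n h is the entry (n + h, n) of Catalan's triangle; ballot n 0 = c_n.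
ballot : ℕ → ℕ → ℕ
ballot zero    h       = 1
ballot (suc n) zero    = ballot n 1
ballot (suc n) (suc h) = ballot n (suc (suc h)) + ballot (suc n) h

ballot-convolution : ∀ n h → ballot n (suc h) ≡ ∑[ i < suc n ] ballot i 0 * ballot (n ∸ i) h
ballot-convolution zero    h       = refl
ballot-convolution (suc m) zero    = begin
  ballot m 2 + ballot (suc m) 0
    ≡⟨ cong₂ _+_ (ballot-convolution m 1) (sym (*-identityʳ _)) ⟩
  (∑[ i < suc m ] ballot i 0 * ballot (suc (m ∸ i)) 0) + ballot (suc m) 0 * 1
    ≡⟨ ∑-convolution-suc m (λ i j → ballot i 0 * ballot j 0) ⟨
  ∑[ i < suc (suc m) ] ballot i 0 * ballot (suc m ∸ i) 0 ∎
ballot-convolution (suc m) (suc h) = begin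
  ballot m (3 + h) + ballot (suc m) (suc h)
    ≡⟨ cong₂ _+_ (ballot-convolution m (2 + h))
                 (trans (ballot-convolution (suc m) h) (∑-convolution-suc m (λ i j → β i * ballot j h))) ⟩
  ∑< (suc m) F + (∑< (suc m) G + β (suc m) * 1)
    ≡⟨ +-assoc (∑< (suc m) F) _ _ ⟨
  ∑< (suc m) F + ∑< (suc m) G + β (suc m) * 1
    ≡⟨ cong (_+ β (suc m) * 1) (∑-+ (suc m) F G) ⟨
  (∑[ i < suc m ] (F i + G i)) + β (suc m) * 1
    ≡⟨ cong (_+ β (suc m) * 1) (∑-cong (suc m) (λ {i} _ → *-distribˡ-+ (β i) _ _)) ⟨
  (∑[ i < suc m ] β i * ballot (suc (m ∸ i)) (suc h)) + β (suc m) * 1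
    ≡⟨ ∑-convolution-suc m (λ i j → β i * ballot j (suc h)) ⟨
  ∑[ i < suc (suc m) ] β i * ballot (suc m ∸ i) (suc h) ∎
  where
  β F G : ℕ → ℕ
  β i = ballot i 0
  F i = β i * ballot (m ∸ i) (2 + h)
  G i = β i * ballot (suc (m ∸ i)) h

ballot-1 : ∀ h → ballot 1 h ≡ suc h
ballot-1 zero    = refl
ballot-1 (suc h) = cong suc (ballot-1 h)

pascal : ∀ n k → suc n C suc k ≡ n C k + n C suc k
pascal n k = sym (nCk+nC[k+1]≡[n+1]C[k+1] n k)

C-symmetric : ∀ {n} k d → n ≡ k + d → n C k ≡ n C d
C-symmetric k d refl = trans (nCk≡nC[n∸k] (m≤m+n k d)) (cong ((k + d) C_) (m+n∸m≡n k d))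

-- ballot (n+1) h = C(N+2, n+1) − C(N+2, n) for N = 2n+h, written without subtraction; N is kept
-- as a variable so that the induction may change n and h independently.
ballot-binomial : ∀ n h {N} → N ≡ n + n + h → ballot (suc n) h + suc (suc N) C n ≡ suc (suc N) C suc n
ballot-binomial zero h refl = begin
  ballot 1 h + 1  ≡⟨ cong (_+ 1) (ballot-1 h) ⟩
  suc h + 1       ≡⟨ +-comm (suc h) 1 ⟩
  suc (suc h)     ≡⟨ nC1≡n (suc (suc h)) ⟨
  suc (suc h) C 1 ∎
ballot-binomial (suc m) zero {suc N} N+1≡ = begin
  ballot (suc m) 1 + suc T C suc m        ≡⟨ cong (ballot (suc m) 1 +_) (pascal T m) ⟩
  ballot (suc m) 1 + (T C m + T C suc m)  ≡⟨ +-assoc (ballot (suc m) 1) _ _ ⟨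
  ballot (suc m) 1 + T C m + T C suc m    ≡⟨ cong (_+ T C suc m) (ballot-binomial m 1 N≡) ⟩
  T C suc m + T C suc m                   ≡⟨ cong (T C suc m +_) (C-symmetric (suc m) (2 + m) T≡) ⟩
  T C suc m + T C (2 + m)                 ≡⟨ pascal T (suc m) ⟨
  suc T C (2 + m)                         ∎
  where
  T = suc (suc N)
  N≡ : N ≡ m + m + 1
  N≡ = trans (suc-injective N+1≡) (arith m)
    where arith : ∀ m → m + suc m + 0 ≡ m + m + 1
          arith = solve-∀
  T≡ : T ≡ suc m + (2 + m)
  T≡ = trans (cong (2 +_) N≡) (arith m)
    where arith : ∀ m → 2 + (m + m + 1) ≡ suc m + (2 + m)
          arith = solve-∀
ballot-binomial (suc m) (suc h) {suc N} N+1≡ = begin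
  ballot (suc m) (2 + h) + ballot (2 + m) h + suc T C suc m
    ≡⟨ cong (ballot (suc m) (2 + h) + ballot (2 + m) h +_) (pascal T m) ⟩
  ballot (suc m) (2 + h) + ballot (2 + m) h + (T C m + T C suc m)
    ≡⟨ interchange (ballot (suc m) (2 + h)) _ _ _ ⟩
  (ballot (suc m) (2 + h) + T C m) + (ballot (2 + m) h + T C suc m)
    ≡⟨ cong₂ _+_ (ballot-binomial m (2 + h) (trans N≡ (arith m h))) (ballot-binomial (suc m) h N≡) ⟩
  T C suc m + T C (2 + m)
    ≡⟨ pascal T (suc m) ⟨
  suc T C (2 + m) ∎
  where
  T = suc (suc N)
  N≡ : N ≡ suc m + suc m + h
  N≡ = suc-injective (trans N+1≡ (+-suc (suc m + suc m) h))
  arith : ∀ m h → suc m + suc m + h ≡ m + m + (2 + h)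
  arith = solve-∀

-- (n − k) C(n, k) = (k + 1) C(n, k + 1), avoiding truncated subtraction.
C-ratio : ∀ n k → suc k * (n C suc k) + k * (n C k) ≡ n * (n C k)
C-ratio zero    zero    = refl
C-ratio zero    (suc k) = cong₂ _+_ (*-zeroʳ (2 + k)) (*-zeroʳ (suc k))
C-ratio (suc n) zero    = trans (+-identityʳ _) (trans (*-identityˡ _) (trans (nC1≡n (suc n)) (sym (*-identityʳ _))))
C-ratio (suc n) (suc k) = begin
  (2 + k) * (suc n C (2 + k)) + suc k * (suc n C suc k)
    ≡⟨ cong₂ (λ a b → (2 + k) * a + suc k * b) (pascal n (suc k)) (pascal n k) ⟩
  (2 + k) * (n C suc k + n C (2 + k)) + suc k * (n C k + n C suc k)
    ≡⟨ arith (n C k) (n C suc k) (n C (2 + k)) k ⟩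
  ((2 + k) * (n C (2 + k)) + suc k * (n C suc k)) + (suc k * (n C suc k) + k * (n C k)) + (n C k + n C suc k)
    ≡⟨ cong (_+ (n C k + n C suc k)) (cong₂ _+_ (C-ratio n (suc k)) (C-ratio n k)) ⟩
  n * (n C suc k) + n * (n C k) + (n C k + n C suc k)
    ≡⟨ arith′ n (n C k) (n C suc k) ⟩
  suc n * (n C k + n C suc k)
    ≡⟨ cong (suc n *_) (pascal n k) ⟨
  suc n * (suc n C suc k) ∎
  where
  arith : ∀ a b c k → (2 + k) * (b + c) + suc k * (a + b) ≡ ((2 + k) * c + suc k * b) + (suc k * b + k * a) + (a + b)
  arith = solve-∀
  arith′ : ∀ n a b → n * b + n * a + (a + b) ≡ suc n * (a + b)
  arith′ = solve-∀

central-C-ratio : ∀ k → let T = 2 + (k + k) in suc k * (T C suc k) ≡ (2 + k) * (T C k)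
central-C-ratio k = +-cancelʳ-≡ (k * (T C k)) _ _ (begin
  suc k * (T C suc k) + k * (T C k) ≡⟨ C-ratio T k ⟩
  T * (T C k)                       ≡⟨ *-distribʳ-+ (T C k) (2 + k) k ⟩
  (2 + k) * (T C k) + k * (T C k)   ∎)
  where T = 2 + (k + k)

central-binomial : ∀ m → (2 * m) C m ≡ suc m * ballot m 0
central-binomial zero    = refl
central-binomial (suc k) = begin
  (2 * suc k) C suc k ≡⟨ cong (_C suc k) (arith k) ⟩
  T C suc k           ≡⟨ +-cancelʳ-≡ (suc k * (T C suc k)) _ _ (begin
      T C suc k + suc k * (T C suc k)              ≡⟨⟩
      (2 + k) * (T C suc k)                        ≡⟨ cong ((2 + k) *_) (ballot-binomial k 0 (sym (+-identityʳ (k + k)))) ⟨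
      (2 + k) * (ballot (suc k) 0 + T C k)          ≡⟨ *-distribˡ-+ (2 + k) (ballot (suc k) 0) (T C k) ⟩
      (2 + k) * ballot (suc k) 0 + (2 + k) * (T C k) ≡⟨ cong ((2 + k) * ballot (suc k) 0 +_) (central-C-ratio k) ⟨
      (2 + k) * ballot (suc k) 0 + suc k * (T C suc k) ∎) ⟩
  (2 + k) * ballot (suc k) 0 ∎
  where
  T = 2 + (k + k)
  arith : ∀ k → 2 * suc k ≡ 2 + (k + k)
  arith = solve-∀

catalan≡ballot : ∀ m → catalan m ≡ ballot m 0
catalan≡ballot m = begin
  ((2 * m) C m) / suc m          ≡⟨ cong (_/ suc m) (trans (central-binomial m) (*-comm (suc m) _)) ⟩
  ballot m 0 * suc m / suc m     ≡⟨ m*n/n≡m (ballot m 0) (suc m) ⟩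
  ballot m 0                     ∎

catalan-suc : ∀ n → catalan (suc n) ≡ ∑[ r < suc n ] catalan r * catalan (n ∸ r)
catalan-suc n = begin
  catalan (suc n)                                      ≡⟨ catalan≡ballot (suc n) ⟩
  ballot n 1                                           ≡⟨ ballot-convolution n 0 ⟩
  ∑[ i < suc n ] ballot i 0 * ballot (n ∸ i) 0
    ≡⟨ ∑-cong (suc n) (λ {i} _ → cong₂ _*_ (catalan≡ballot i) (catalan≡ballot (n ∸ i))) ⟨
  ∑[ r < suc n ] catalan r * catalan (n ∸ r)           ∎

HasCard-cong : (∀ x → P x ⇔ Q x) → HasCard P k → HasCard Q k
HasCard-cong P⇔Q (xs , unique , ∈⇔P , length≡) =
  xs , unique , (λ x → mk⇔ (to (P⇔Q x) ∘ to (∈⇔P x)) (from (∈⇔P x) ∘ from (P⇔Q x))) , length≡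

Unique-map⁺-on : ∀ {f : A → B} {xs} → (∀ {x y} → P x → P y → f x ≡ f y → x ≡ y) →
              All P xs → Unique xs → Unique (map f xs)
Unique-map⁺-on f-inj []         []            = []
Unique-map⁺-on f-inj (px ∷ pxs) (x∉xs ∷ uxs) =
  All.map⁺ (All.zipWith (λ (x≢y , py) fx≡fy → x≢y (f-inj px py fx≡fy)) (x∉xs , pxs))
  ∷ Unique-map⁺-on f-inj pxs uxs

HasCard-map : {P : A → Set} {Q : B → Set} (f : A → B) → (∀ {x y} → P x → P y → f x ≡ f y → x ≡ y) →
              (∀ y → Q y ⇔ (∃[ x ] P x × f x ≡ y)) → HasCard P k → HasCard Q k
HasCard-map {P = P} {Q} f f-inj Q⇔image (xs , unique , ∈⇔P , length≡) =
  map f xs ,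
  Unique-map⁺-on f-inj (All.tabulate (λ {x} → to (∈⇔P x))) unique ,
  (λ y → mk⇔ (image⇒Q y) (Q⇒image y)) ,
  trans (length-map f xs) length≡
  where
  image⇒Q : ∀ y → y ∈ map f xs → Q y
  image⇒Q y y∈ with ∈-map⁻ f y∈
  ... | x , x∈ , refl = from (Q⇔image (f x)) (x , to (∈⇔P x) x∈ , refl)
  Q⇒image : ∀ y → Q y → y ∈ map f xs
  Q⇒image y Qy with to (Q⇔image y) Qy
  ... | x , Px , refl = ∈-map⁺ f (from (∈⇔P x) Px)

HasCard-∅ : (∀ x → ¬ P x) → HasCard P 0
HasCard-∅ ¬P = [] , [] , (λ x → mk⇔ (λ ()) (λ Px → ⊥-elim (¬P x Px))) , refl

HasCard-singleton : (a : A) → HasCard (_≡ a) 1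
HasCard-singleton a = a ∷ [] , [] ∷ [] , (λ x → mk⇔ (λ { (here x≡a) → x≡a ; (there ()) }) here) , refl

HasCard-⊎ : HasCard P k → HasCard Q m → (∀ x → P x → ¬ Q x) → HasCard (λ x → P x ⊎ Q x) (k + m)
HasCard-⊎ {P = P} {Q = Q} (xs , uxs , ∈⇔P , lxs) (ys , uys , ∈⇔Q , lys) disjoint =
  xs ++ ys ,
  Unique.++⁺ uxs uys (λ {x} (x∈xs , x∈ys) → disjoint x (to (∈⇔P x) x∈xs) (to (∈⇔Q x) x∈ys)) ,
  (λ x → mk⇔ (∈++⇒ x) (⇒∈++ x)) ,
  trans (length-++ xs) (cong₂ _+_ lxs lys)
  where
  ∈++⇒ : ∀ x → x ∈ xs ++ ys → P x ⊎ Q x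
  ∈++⇒ x x∈ with ∈-++⁻ xs x∈
  ... | inj₁ x∈xs = inj₁ (to (∈⇔P x) x∈xs)
  ... | inj₂ x∈ys = inj₂ (to (∈⇔Q x) x∈ys)
  ⇒∈++ : ∀ x → P x ⊎ Q x → x ∈ xs ++ ys
  ⇒∈++ x (inj₁ Px) = ∈-++⁺ˡ (from (∈⇔P x) Px)
  ⇒∈++ x (inj₂ Qx) = ∈-++⁺ʳ xs (from (∈⇔Q x) Qx)

length-cartesianProduct : (xs : List A) (ys : List B) → length (cartesianProduct xs ys) ≡ length xs * length ys
length-cartesianProduct []       ys = refl
length-cartesianProduct (x ∷ xs) ys =
  trans (length-++ (map (x ,_) ys)) (cong₂ _+_ (length-map (x ,_) ys) (length-cartesianProduct xs ys))

HasCard-× : HasCard P k → HasCard Q m → HasCard (λ (x , y) → P x × Q y) (k * m)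
HasCard-× (xs , uxs , ∈⇔P , lxs) (ys , uys , ∈⇔Q , lys) =
  cartesianProduct xs ys ,
  Unique.cartesianProduct⁺ uxs uys ,
  (λ (x , y) → mk⇔
     (λ xy∈ → let x∈ , y∈ = ∈-cartesianProduct⁻ xs ys xy∈ in to (∈⇔P x) x∈ , to (∈⇔Q y) y∈)
     (λ (Px , Qy) → ∈-cartesianProduct⁺ (from (∈⇔P x) Px) (from (∈⇔Q y) Qy))) ,
  trans (length-cartesianProduct xs ys) (cong₂ _*_ lxs lys)

HasCard-∑ : ∀ n {P : ℕ → A → Set} {f : ℕ → ℕ} → (∀ {r} → r < n → HasCard (P r) (f r)) →
            (∀ {r s x} → P r x → P s x → r ≡ s) →
            HasCard (λ x → ∃[ r ] r < n × P r x) (∑< n f)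
HasCard-∑ zero    _       _          = HasCard-∅ (λ { _ (_ , () , _) })
HasCard-∑ (suc n) {P} card functional =
  HasCard-cong (λ x → mk⇔ merge (split x))
    (HasCard-⊎ (HasCard-∑ n (λ r<n → card (m<n⇒m<1+n r<n)) functional) (card ≤-refl)
               (λ { x (r , r<n , Prx) Pnx → <-irrefl (functional Prx Pnx) r<n }))
  where
  merge : ∀ {x} → (∃[ r ] r < n × P r x) ⊎ P n x → ∃[ r ] r < suc n × P r x
  merge (inj₁ (r , r<n , Prx)) = r , m<n⇒m<1+n r<n , Prx
  merge (inj₂ Pnx)             = n , ≤-refl , Pnx
  split : ∀ x → (∃[ r ] r < suc n × P r x) → (∃[ r ] r < n × P r x) ⊎ P n x
  split x (r , r<1+n , Prx) with m<1+n⇒m<n∨m≡n r<1+n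
  ... | inj₁ r<n  = inj₁ (r , r<n , Prx)
  ... | inj₂ refl = inj₂ Prx

-- Nested sequences

-- Indexing that returns 0 past the end of the list.
at : List ℕ → ℕ → ℕ
at []       _       = 0
at (x ∷ xs) zero    = x
at (x ∷ xs) (suc i) = at xs i

at-++ˡ : ∀ p {s i} → i < length p → at (p ++ s) i ≡ at p i
at-++ˡ (x ∷ p) {i = zero}  _         = refl
at-++ˡ (x ∷ p) {i = suc i} (s<s i<p) = at-++ˡ p i<p

at-++ʳ : ∀ p {s} k → at (p ++ s) (length p + k) ≡ at s k
at-++ʳ []      k = refl
at-++ʳ (x ∷ p) k = at-++ʳ p k

at-map : ∀ f s {k} → k < length s → at (map f s) k ≡ f (at s k)
at-map f (x ∷ s) {zero}  _         = refl
at-map f (x ∷ s) {suc k} (s<s k<s) = at-map f s k<s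

at-∷ʳ : ∀ l y → at (l ∷ʳ y) (length l) ≡ y
at-∷ʳ []      y = refl
at-∷ʳ (x ∷ l) y = at-∷ʳ l y

length-∷ʳ : ∀ (l : List ℕ) y → length (l ∷ʳ y) ≡ suc (length l)
length-∷ʳ []      y = refl
length-∷ʳ (x ∷ l) y = cong suc (length-∷ʳ l y)

<-+⇒<⊎∃ : ∀ m {n i} → i < m + n → i < m ⊎ ∃[ k ] k < n × m + k ≡ i
<-+⇒<⊎∃ zero    i<n = inj₂ (_ , i<n , refl)
<-+⇒<⊎∃ (suc m) {i = zero}  _ = inj₁ z<s
<-+⇒<⊎∃ (suc m) {i = suc i} (s<s i<m+n) =
  Sum.map s<s (λ (k , k<n , m+k≡i) → k , k<n , cong suc m+k≡i) (<-+⇒<⊎∃ m i<m+n)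

NestedAt : List ℕ → ℕ → Set
NestedAt l i = at l i ≤ i × (∀ {j} → at l i ≤ j → j ≤ i → at l i ≤ at l j)

Nested : List ℕ → Set
Nested l = ∀ {i} → i < length l → NestedAt l i

-- For l ∷ʳ x ∈ 𝒞, the set S(l ∷ʳ x) of the paper is { y ∣ Admissible l y }.
Admissible : List ℕ → ℕ → Set
Admissible l y = y ≤ length l × (∀ {j} → y ≤ j → j < length l → y ≤ at l j)

NestedAt-cong : ∀ l l′ {i} → (∀ {j} → j ≤ i → at l j ≡ at l′ j) → NestedAt l i → NestedAt l′ i
NestedAt-cong l l′ {i} agree (ai≤i , ai≤aj) =
  subst (_≤ i) (agree ≤-refl) ai≤i ,
  λ ai≤j j≤i → subst₂ _≤_ (agree ≤-refl) (agree j≤i) (ai≤aj (subst (_≤ _) (sym (agree ≤-refl)) ai≤j) j≤i)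

NestedAt-++ˡ : ∀ p {s i} → i < length p → NestedAt (p ++ s) i ⇔ NestedAt p i
NestedAt-++ˡ p {s} i<p = mk⇔ (NestedAt-cong (p ++ s) p (λ j≤i → at-++ˡ p (≤-<-trans j≤i i<p)))
                             (NestedAt-cong p (p ++ s) (λ j≤i → sym (at-++ˡ p (≤-<-trans j≤i i<p))))

NestedAt-last⇔Admissible : ∀ l y → NestedAt (l ∷ʳ y) (length l) ⇔ Admissible l y
NestedAt-last⇔Admissible l y rewrite at-∷ʳ l y = mk⇔
  (λ (y≤L , y≤a) → y≤L , λ y≤j j<L → subst (y ≤_) (at-++ˡ l j<L) (y≤a y≤j (<⇒≤ j<L)))
  (λ (y≤L , y≤a) → y≤L , λ {j} y≤j j≤L → case j≤L y≤a y≤j)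
  where
  case : ∀ {j} → j ≤ length l → (∀ {j} → y ≤ j → j < length l → y ≤ at l j) → y ≤ j →
         y ≤ at (l ∷ʳ y) j
  case j≤L y≤a y≤j with m≤n⇒m<n∨m≡n j≤L
  ... | inj₁ j<L  = subst (y ≤_) (sym (at-++ˡ l j<L)) (y≤a y≤j j<L)
  ... | inj₂ refl = ≤-reflexive (sym (at-∷ʳ l y))

Nested-∷ʳ : ∀ l y → Nested (l ∷ʳ y) ⇔ (Nested l × Admissible l y)
Nested-∷ʳ l y = mk⇔ split combine
  where
  <-∷ʳ : ∀ {i} → i < suc (length l) → i < length (l ∷ʳ y)
  <-∷ʳ = subst (_ <_) (sym (length-∷ʳ l y))
  split : Nested (l ∷ʳ y) → Nested l × Admissible l y
  split nested = (λ i<L → to (NestedAt-++ˡ l i<L) (nested (<-∷ʳ (m<n⇒m<1+n i<L))))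
               , to (NestedAt-last⇔Admissible l y) (nested (<-∷ʳ ≤-refl))
  combine : Nested l × Admissible l y → Nested (l ∷ʳ y)
  combine (nested , admissible) i<L+1 with m<1+n⇒m<n∨m≡n (subst (_ <_) (length-∷ʳ l y) i<L+1)
  ... | inj₁ i<L  = from (NestedAt-++ˡ l i<L) (nested i<L)
  ... | inj₂ refl = from (NestedAt-last⇔Admissible l y) admissible

module _ (p s : List ℕ) where

  private
    L = length p

  at-shift : ∀ {k} → k < length s → at (p ++ map (L +_) s) (L + k) ≡ L + at s k
  at-shift {k} k<s = trans (at-++ʳ p k) (at-map (L +_) s k<s)

  NestedAt-shift : ∀ {k} → k < length s → NestedAt (p ++ map (L +_) s) (L + k) ⇔ NestedAt s k
  NestedAt-shift {k} k<s rewrite at-shift k<s = mk⇔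
    (λ (≤k , ≤aj) → +-cancelˡ-≤ L _ _ ≤k ,
                    λ {j} sk≤j j≤k → +-cancelˡ-≤ L _ _
                      (subst (L + at s k ≤_) (at-shift (≤-<-trans j≤k k<s))
                             (≤aj (+-monoʳ-≤ L sk≤j) (+-monoʳ-≤ L j≤k))))
    (λ (≤k , ≤aj) → +-monoʳ-≤ L ≤k , shifted ≤aj)
    where
    shifted : (∀ {j} → at s k ≤ j → j ≤ k → at s k ≤ at s j) →
              ∀ {j} → L + at s k ≤ j → j ≤ L + k → L + at s k ≤ at (p ++ map (L +_) s) j
    shifted ≤aj lo hi with m≤n⇒∃[o]m+o≡n (≤-trans (m≤m+n L _) lo)
    ... | j , refl = subst (L + at s k ≤_) (sym (at-shift (≤-<-trans j≤k k<s)))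
                           (+-monoʳ-≤ L (≤aj (+-cancelˡ-≤ L _ _ lo) j≤k))
      where j≤k = +-cancelˡ-≤ L _ _ hi

  Nested-++-shift : Nested (p ++ map (L +_) s) ⇔ (Nested p × Nested s)
  Nested-++-shift = mk⇔ split combine
    where
    length-whole : length (p ++ map (L +_) s) ≡ L + length s
    length-whole = trans (length-++ p) (cong (L +_) (length-map (L +_) s))
    <-whole : ∀ {i} → i < L + length s → i < length (p ++ map (L +_) s)
    <-whole = subst (_ <_) (sym length-whole)
    split : Nested (p ++ map (L +_) s) → Nested p × Nested s
    split nested = (λ i<L → to (NestedAt-++ˡ p i<L) (nested (<-whole (≤-trans i<L (m≤m+n L _)))))
                 , (λ k<s → to (NestedAt-shift k<s) (nested (<-whole (+-monoʳ-< L k<s))))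
    combine : Nested p × Nested s → Nested (p ++ map (L +_) s)
    combine (nested-p , nested-s) i< with <-+⇒<⊎∃ L (subst (_ <_) length-whole i<)
    ... | inj₁ i<L              = from (NestedAt-++ˡ p i<L) (nested-p i<L)
    ... | inj₂ (k , k<s , refl) = from (NestedAt-shift k<s) (nested-s k<s)

Admissible-∷ʳ : ∀ l x y → Admissible (l ∷ʳ x) y ⇔ (y ≡ suc (length l) ⊎ Admissible l y × y ≤ x)
Admissible-∷ʳ l x y = mk⇔ split combine
  where
  L+1≡ = length-∷ʳ l x
  <-∷ʳ : ∀ {j} → j < suc (length l) → j < length (l ∷ʳ x)
  <-∷ʳ = subst (_ <_) (sym L+1≡)
  split : Admissible (l ∷ʳ x) y → y ≡ suc (length l) ⊎ Admissible l y × y ≤ x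
  split (y≤L+1 , y≤a) with m≤n⇒m<n∨m≡n (subst (y ≤_) L+1≡ y≤L+1)
  ... | inj₂ y≡L+1 = inj₁ y≡L+1
  ... | inj₁ y<L+1 =
    inj₂ ((m<1+n⇒m≤n y<L+1 , λ y≤j j<L → subst (y ≤_) (at-++ˡ l j<L) (y≤a y≤j (<-∷ʳ (m<n⇒m<1+n j<L))))
         , subst (y ≤_) (at-∷ʳ l x) (y≤a (m<1+n⇒m≤n y<L+1) (<-∷ʳ ≤-refl)))
  combine : y ≡ suc (length l) ⊎ Admissible l y × y ≤ x → Admissible (l ∷ʳ x) y
  combine (inj₁ refl) = ≤-reflexive (sym L+1≡) , λ y≤j j<L+1 → contradiction y≤j (<⇒≱ (subst (_ <_) L+1≡ j<L+1))
  combine (inj₂ ((y≤L , y≤a) , y≤x)) =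
    subst (y ≤_) (sym L+1≡) (m≤n⇒m≤1+n y≤L) ,
    λ {j} y≤j j<L+1 → case j (m<1+n⇒m<n∨m≡n (subst (_ <_) L+1≡ j<L+1)) y≤j
    where
    case : ∀ j → j < length l ⊎ j ≡ length l → y ≤ j → y ≤ at (l ∷ʳ x) j
    case j (inj₁ j<L)  y≤j = subst (y ≤_) (sym (at-++ˡ l j<L)) (y≤a y≤j j<L)
    case j (inj₂ refl) _   = subst (y ≤_) (sym (at-∷ʳ l x)) y≤x

Nested-∷ʳ-∷ʳ : ∀ l x y →
  Nested (l ∷ʳ x ∷ʳ y) ⇔ (Nested (l ∷ʳ x) × (y ≡ suc (length l) ⊎ Nested (l ∷ʳ y) × y ≤ x))
Nested-∷ʳ-∷ʳ l x y = mk⇔ split combine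
  where
  split : Nested (l ∷ʳ x ∷ʳ y) → Nested (l ∷ʳ x) × (y ≡ suc (length l) ⊎ Nested (l ∷ʳ y) × y ≤ x)
  split nested with to (Nested-∷ʳ (l ∷ʳ x) y) nested
  ... | nested-lx , admissible with to (Admissible-∷ʳ l x y) admissible
  ... | inj₁ y≡L+1 = nested-lx , inj₁ y≡L+1
  ... | inj₂ (admissible-l , y≤x) =
    nested-lx , inj₂ (from (Nested-∷ʳ l y) (proj₁ (to (Nested-∷ʳ l x) nested-lx) , admissible-l) , y≤x)
  combine : Nested (l ∷ʳ x) × (y ≡ suc (length l) ⊎ Nested (l ∷ʳ y) × y ≤ x) → Nested (l ∷ʳ x ∷ʳ y)
  combine (nested-lx , inj₁ y≡L+1) =
    from (Nested-∷ʳ (l ∷ʳ x) y) (nested-lx , from (Admissible-∷ʳ l x y) (inj₁ y≡L+1))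
  combine (nested-lx , inj₂ (nested-ly , y≤x)) =
    from (Nested-∷ʳ (l ∷ʳ x) y)
         (nested-lx , from (Admissible-∷ʳ l x y) (inj₂ (proj₂ (to (Nested-∷ʳ l y) nested-ly) , y≤x)))

++-injective : ∀ {xs ys xs′ ys′ : List A} → length xs ≡ length ys → xs ++ xs′ ≡ ys ++ ys′ →
               xs ≡ ys × xs′ ≡ ys′
++-injective {xs = []}     {[]}     _   eq = refl , eq
++-injective {xs = x ∷ xs} {y ∷ ys} len eq with ∷-injective eq
... | refl , eq′ with ++-injective {xs = xs} {ys} (suc-injective len) eq′
... | refl , eq″ = refl , eq″

join : List ℕ → List ℕ → List ℕ
join p q = p ++ map (length p +_) (q ∷ʳ 0)

join≡ : ∀ p q → join p q ≡ (p ++ map (length p +_) q) ∷ʳ length p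
join≡ p q = begin
  p ++ map (L +_) (q ∷ʳ 0)        ≡⟨ cong (p ++_) (map-++ (L +_) q [ 0 ]) ⟩
  p ++ (map (L +_) q ∷ʳ (L + 0))  ≡⟨ ++-assoc p _ _ ⟨
  (p ++ map (L +_) q) ∷ʳ (L + 0)  ≡⟨ cong ((p ++ map (L +_) q) ∷ʳ_) (+-identityʳ L) ⟩
  (p ++ map (L +_) q) ∷ʳ L        ∎
  where
  L = length p

join-injective : ∀ {p q p′ q′} → join p q ≡ join p′ q′ → p ≡ p′ × q ≡ q′
join-injective {p} {q} {p′} {q′} eq with ∷ʳ-injective _ _ (trans (sym (join≡ p q)) (trans eq (join≡ p′ q′)))
... | body≡ , L≡L′ with ++-injective {xs = p} {p′} L≡L′ body≡
... | refl , shifted≡ = refl , map-injective (λ {x} {y} → +-cancelˡ-≡ (length p) x y) shifted≡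

length-join : ∀ p q → length (join p q) ≡ length p + suc (length q)
length-join p q = trans (length-++ p) (cong (length p +_) (trans (length-map _ (q ∷ʳ 0)) (length-∷ʳ q 0)))

at-join : ∀ p q → at (join p q) (length p + length q) ≡ length p
at-join p q = begin
  at (join p q) (L + length q)       ≡⟨ at-++ʳ p (length q) ⟩
  at (map (L +_) (q ∷ʳ 0)) (length q) ≡⟨ at-map (L +_) (q ∷ʳ 0) (subst (length q <_) (sym (length-∷ʳ q 0)) ≤-refl) ⟩
  L + at (q ∷ʳ 0) (length q)         ≡⟨ cong (L +_) (at-∷ʳ q 0) ⟩
  L + 0                              ≡⟨ +-identityʳ L ⟩
  L                                  ∎
  where
  L = length p

Nested-join : ∀ p q → Nested (join p q) ⇔ (Nested p × Nested q)
Nested-join p q = mk⇔ split combine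
  where
  split : Nested (join p q) → Nested p × Nested q
  split nested with to (Nested-++-shift p (q ∷ʳ 0)) nested
  ... | nested-p , nested-q0 = nested-p , proj₁ (to (Nested-∷ʳ q 0) nested-q0)
  combine : Nested p × Nested q → Nested (join p q)
  combine (nested-p , nested-q) =
    from (Nested-++-shift p (q ∷ʳ 0)) (nested-p , from (Nested-∷ʳ q 0) (nested-q , z≤n , λ _ _ → z≤n))

All-drop : ∀ {P : ℕ → Set} r l → (∀ {j} → r ≤ j → j < length l → P (at l j)) → All P (drop r l)
All-drop zero    []      _ = []
All-drop zero    (x ∷ l) h = h z≤n z<s ∷ All-drop zero l (λ _ j<l → h z≤n (s<s j<l))
All-drop (suc r) []      _ = []
All-drop (suc r) (x ∷ l) h = All-drop r l (λ r≤j j<l → h (s≤s r≤j) (s<s j<l))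

Admissible⇒++-shift : ∀ l r → Admissible l r →
                      ∃[ p ] ∃[ q ] length p ≡ r × length q ≡ length l ∸ r × p ++ map (r +_) q ≡ l
Admissible⇒++-shift l r (r≤L , r≤a) =
  take r l , map (_∸ r) (drop r l) ,
  trans (length-take r l) (m≤n⇒m⊓n≡m r≤L) ,
  trans (length-map (_∸ r) (drop r l)) (length-drop r l) ,
  trans (cong (take r l ++_) unshift) (take++drop≡id r l)
  where
  unshift : map (r +_) (map (_∸ r) (drop r l)) ≡ drop r l
  unshift = trans (sym (map-∘ (drop r l))) (map-id-local (All.map m+[n∸m]≡n (All-drop r l r≤a)))

Nested-∷ʳ⇒join : ∀ l r → Nested (l ∷ʳ r) →
                 ∃[ p ] ∃[ q ] length p ≡ r × length q ≡ length l ∸ r × Nested p × Nested q × join p q ≡ l ∷ʳ r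
Nested-∷ʳ⇒join l r nested with to (Nested-∷ʳ l r) nested
... | nested-l , admissible with Admissible⇒++-shift l r admissible
... | p , q , refl , length-q , refl with to (Nested-++-shift p q) nested-l
... | nested-p , nested-q = p , q , refl , length-q , nested-p , nested-q , join≡ p q

NestedOfLength : ℕ → List ℕ → Set
NestedOfLength n l = length l ≡ n × Nested l

NestedEndingIn : ℕ → ℕ → List ℕ → Set
NestedEndingIn n r l = length l ≡ suc n × (Nested l × at l n ≡ r)

HasCard-NestedOfLength-zero : HasCard (NestedOfLength 0) 1
HasCard-NestedOfLength-zero = HasCard-cong (λ l → mk⇔ (λ { refl → refl , λ () }) (empty l)) (HasCard-singleton [])
  where
  empty : ∀ l → NestedOfLength 0 l → l ≡ []
  empty [] _ = refl

join-NestedEndingIn : ∀ {n r p q} → length p ≡ r → r ≤ n → length q ≡ n ∸ r → Nested p → Nested q →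
                      NestedEndingIn n r (join p q)
join-NestedEndingIn {n} {p = p} {q} refl r≤n len-q nested-p nested-q =
  trans (length-join p q) (trans (+-suc (length p) _) (cong suc p+q≡n)) ,
  from (Nested-join p q) (nested-p , nested-q) ,
  subst (λ k → at (join p q) k ≡ length p) p+q≡n (at-join p q)
  where
  p+q≡n : length p + length q ≡ n
  p+q≡n = trans (cong (length p +_) len-q) (m+[n∸m]≡n r≤n)

NestedEndingIn⇒join : ∀ {n r l} → NestedEndingIn n r l →
                      ∃[ p ] ∃[ q ] length p ≡ r × length q ≡ n ∸ r × Nested p × Nested q × join p q ≡ l
NestedEndingIn⇒join {l = l} (length≡ , nested , last≡r) with initLast l
... | m ∷ʳ′ x with suc-injective (trans (sym (length-∷ʳ m x)) length≡)
... | refl with trans (sym (at-∷ʳ m x)) last≡r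
... | refl = Nested-∷ʳ⇒join m x nested

HasCard-NestedEndingIn : ∀ {n r a b} → r ≤ n → HasCard (NestedOfLength r) a → HasCard (NestedOfLength (n ∸ r)) b →
                         HasCard (NestedEndingIn n r) (a * b)
HasCard-NestedEndingIn {n} {r} r≤n card-r card-n∸r =
  HasCard-map (uncurry join) (λ _ _ → uncurry-join-injective) (λ l → mk⇔ (split l) (combine l))
              (HasCard-× card-r card-n∸r)
  where
  Pieces : List ℕ × List ℕ → Set
  Pieces (p , q) = NestedOfLength r p × NestedOfLength (n ∸ r) q
  uncurry-join-injective : ∀ {pq pq′} → uncurry join pq ≡ uncurry join pq′ → pq ≡ pq′
  uncurry-join-injective {p , q} {p′ , q′} eq with join-injective {p} {q} {p′} {q′} eq
  ... | refl , refl = refl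
  split : ∀ l → NestedEndingIn n r l → ∃[ pq ] Pieces pq × uncurry join pq ≡ l
  split l ending with NestedEndingIn⇒join ending
  ... | p , q , len-p , len-q , nested-p , nested-q , join≡ = (p , q) , ((len-p , nested-p) , (len-q , nested-q)) , join≡
  combine : ∀ l → (∃[ pq ] Pieces pq × uncurry join pq ≡ l) → NestedEndingIn n r l
  combine l ((p , q) , ((len-p , nested-p) , (len-q , nested-q)) , join≡) =
    subst (NestedEndingIn n r) join≡ (join-NestedEndingIn {p = p} {q} len-p r≤n len-q nested-p nested-q)

∃NestedEndingIn⇔NestedOfLength : ∀ n l → (∃[ r ] r < suc n × NestedEndingIn n r l) ⇔ NestedOfLength (suc n) l
∃NestedEndingIn⇔NestedOfLength n l = mk⇔ (λ (_ , _ , len , nested , _) → len , nested) by-last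
  where
  by-last : NestedOfLength (suc n) l → ∃[ r ] r < suc n × NestedEndingIn n r l
  by-last (len , nested) = at l n , s≤s (proj₁ (nested (subst (n <_) (sym len) ≤-refl))) , len , nested , refl

HasCard-NestedOfLength : ∀ n → HasCard (NestedOfLength n) (catalan n)
HasCard-NestedOfLength = <-rec _ λ where
  zero    _   → HasCard-NestedOfLength-zero
  (suc n) rec → subst (HasCard _) (sym (catalan-suc n))
    (HasCard-cong (∃NestedEndingIn⇔NestedOfLength n)
      (HasCard-∑ (suc n)
        (λ {r} r<1+n → let r≤n = m<1+n⇒m≤n r<1+n in
                       HasCard-NestedEndingIn r≤n (rec (s≤s r≤n)) (rec (s≤s (m∸n≤m n r))))
        (λ (_ , _ , last≡r) (_ , _ , last≡s) → trans (sym last≡r) last≡s)))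

-- Vectors: the family 𝒞 and self-describing sequences

-- Pads with 0 or truncates; only ever applied to lists of length m.
toVec : ∀ m → List ℕ → Vec ℕ m
toVec zero    _        = Vec.[]
toVec (suc m) []       = 0 Vec.∷ toVec m []
toVec (suc m) (x ∷ xs) = x Vec.∷ toVec m xs

toVec-toList : ∀ {m} (a : Vec ℕ m) → toVec m (toList a) ≡ a
toVec-toList Vec.[]       = refl
toVec-toList (x Vec.∷ a) = cong (x Vec.∷_) (toVec-toList a)

toList-toVec : ∀ {m} l → length l ≡ m → toList (toVec m l) ≡ l
toList-toVec []      refl = refl
toList-toVec (x ∷ l) refl = cong (x ∷_) (toList-toVec l refl)

HasCard-toList : ∀ {m k} {P : List ℕ → Set} {Q : Vec ℕ m → Set} → (∀ a → Q a ⇔ P (toList a)) →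
                 HasCard (λ l → length l ≡ m × P l) k → HasCard Q k
HasCard-toList {m} {P = P} {Q} Q⇔P = HasCard-map (toVec m) injective (λ a → mk⇔ (split a) combine)
  where
  injective : ∀ {l l′} → length l ≡ m × P l → length l′ ≡ m × P l′ → toVec m l ≡ toVec m l′ → l ≡ l′
  injective {l} {l′} (len , _) (len′ , _) eq =
    trans (sym (toList-toVec l len)) (trans (cong toList eq) (toList-toVec l′ len′))
  split : ∀ a → Q a → ∃[ l ] (length l ≡ m × P l) × toVec m l ≡ a
  split a Qa = toList a , (length-toList a , to (Q⇔P a) Qa) , toVec-toList a
  combine : ∀ {a} → (∃[ l ] (length l ≡ m × P l) × toVec m l ≡ a) → Q a
  combine (l , (len , Pl) , refl) = from (Q⇔P (toVec m l)) (subst P (sym (toList-toVec l len)) Pl)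

at-toList : ∀ {n} (a : Vec ℕ n) (i : Fin n) → at (toList a) (toℕ i) ≡ lookup a i
at-toList (x Vec.∷ a) Fin.zero    = refl
at-toList (x Vec.∷ a) (Fin.suc i) = at-toList a i

-- last is defined through initLast, so matching on initLast a also rewrites last a to y.
at-toList-last : ∀ {n} (a : Vec ℕ (suc n)) → at (toList a) n ≡ last a
at-toList-last {n} a with Vec.initLast a
... | b , y , refl = begin
  at (toList (b ∷ʳᵛ y)) n                 ≡⟨ cong (λ l → at l n) (toList-∷ʳ y b) ⟩
  at (toList b ∷ʳ y) n                    ≡⟨ cong (at (toList b ∷ʳ y)) (length-toList b) ⟨
  at (toList b ∷ʳ y) (length (toList b))  ≡⟨ at-∷ʳ (toList b) y ⟩
  y                                       ∎

Nested-toList-∷ʳ-∷ʳ : ∀ {n} (xs : Vec ℕ n) x y →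
  Nested (toList (xs ∷ʳᵛ x ∷ʳᵛ y)) ⇔
  (Nested (toList (xs ∷ʳᵛ x)) × (y ≡ suc n ⊎ Nested (toList (xs ∷ʳᵛ y)) × y ≤ x))
Nested-toList-∷ʳ-∷ʳ xs x y
  rewrite toList-∷ʳ y (xs ∷ʳᵛ x) | toList-∷ʳ x xs | toList-∷ʳ y xs =
  subst (λ L → Nested (l ∷ʳ x ∷ʳ y) ⇔ (Nested (l ∷ʳ x) × (y ≡ suc L ⊎ Nested (l ∷ʳ y) × y ≤ x)))
        (length-toList xs) (Nested-∷ʳ-∷ʳ l x y)
  where l = toList xs

CatC⇒Nested : ∀ {n a} → CatC n a → Nested (toList a)
CatC⇒Nested base                  = from (Nested-∷ʳ [] 0) ((λ ()) , z≤n , λ _ ())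
CatC⇒Nested (new {xs = xs} {x} c) = from (Nested-toList-∷ʳ-∷ʳ xs x _) (CatC⇒Nested c , inj₁ refl)
CatC⇒Nested (old {xs = xs} {x} {y} c c′ y≤x) =
  from (Nested-toList-∷ʳ-∷ʳ xs x y) (CatC⇒Nested c , inj₂ (CatC⇒Nested c′ , y≤x))

Nested⇒CatC : ∀ n (a : Vec ℕ (suc n)) → Nested (toList a) → CatC n a
Nested⇒CatC zero (v Vec.∷ Vec.[]) nested with n≤0⇒n≡0 (proj₁ (nested z<s))
... | refl = base
Nested⇒CatC (suc n) a nested with Vec.initLast a
... | b , y , refl with Vec.initLast b
... | xs , x , refl with to (Nested-toList-∷ʳ-∷ʳ xs x y) nested
... | nested-x , inj₁ refl              = new (Nested⇒CatC n (xs ∷ʳᵛ x) nested-x)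
... | nested-x , inj₂ (nested-y , y≤x) =
  old (Nested⇒CatC n (xs ∷ʳᵛ x) nested-x) (Nested⇒CatC n (xs ∷ʳᵛ y) nested-y) y≤x

CatC⇔Nested : ∀ {n} (a : Vec ℕ (suc n)) → CatC n a ⇔ Nested (toList a)
CatC⇔Nested a = mk⇔ CatC⇒Nested (Nested⇒CatC _ a)

𝟙 : {P : Set} → Dec P → ℕ
𝟙 (yes _) = 1
𝟙 (no _)  = 0

𝟙-cong : ∀ {P Q : Set} (P? : Dec P) (Q? : Dec Q) → P ⇔ Q → 𝟙 P? ≡ 𝟙 Q?
𝟙-cong (yes _) (yes _)  _   = refl
𝟙-cong (no _)  (no _)   _   = refl
𝟙-cong (yes p) (no ¬q)  P⇔Q = contradiction (to P⇔Q p) ¬q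
𝟙-cong (no ¬p) (yes q)  P⇔Q = contradiction (from P⇔Q q) ¬p

𝟙-yes : ∀ {P : Set} (P? : Dec P) → P → 𝟙 P? ≡ 1
𝟙-yes (yes _) _ = refl
𝟙-yes (no ¬p) p = contradiction p ¬p

𝟙-no : ∀ {P : Set} (P? : Dec P) → ¬ P → 𝟙 P? ≡ 0
𝟙-no (yes p) ¬p = contradiction p ¬p
𝟙-no (no _)  _  = refl

𝟙≡0⇒¬ : ∀ {P : Set} (P? : Dec P) → 𝟙 P? ≡ 0 → ¬ P
𝟙≡0⇒¬ (no ¬p) _ = ¬p

𝟙≤1 : ∀ {P : Set} (P? : Dec P) → 𝟙 P? ≤ 1
𝟙≤1 (yes _) = ≤-refl
𝟙≤1 (no _)  = z≤n

length-filter-tabulate : ∀ {A : Set} {m} {P : A → Set} (P? : Decidable P) {Q : ℕ → Set} (Q? : Decidable Q)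
                         (f : Fin m → A) → (∀ j → P (f j) ⇔ Q (toℕ j)) →
                         length (filter P? (tabulate f)) ≡ ∑[ k < m ] 𝟙 (Q? k)
length-filter-tabulate {m = zero}  P? Q? f P⇔Q = refl
length-filter-tabulate {m = suc m} P? Q? f P⇔Q = begin
  length (filter P? (tabulate f))                          ≡⟨ length-filter-∷ ⟩
  𝟙 (P? (f Fin.zero)) + length (filter P? (tabulate (f ∘ Fin.suc)))
    ≡⟨ cong₂ _+_ (𝟙-cong (P? _) (Q? 0) (P⇔Q Fin.zero))
                 (length-filter-tabulate P? (Q? ∘ suc) (f ∘ Fin.suc) (P⇔Q ∘ Fin.suc)) ⟩
  𝟙 (Q? 0) + (∑[ k < m ] 𝟙 (Q? (suc k)))                    ≡⟨ ∑-split 1 m (λ k → 𝟙 (Q? k)) ⟨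
  ∑[ k < suc m ] 𝟙 (Q? k)                                  ∎
  where
  length-filter-∷ : ∀ {x xs} → length (filter P? (x ∷ xs)) ≡ 𝟙 (P? x) + length (filter P? xs)
  length-filter-∷ {x} with P? x
  ... | yes _ = refl
  ... | no _  = refl

countLess : List ℕ → ℕ → ℕ → ℕ
countLess l t v = ∑[ k < t ] 𝟙 (at l k <? v)

countLess-≤ : ∀ l t v → countLess l t v ≤ t
countLess-≤ l t v = ≤-trans (∑-mono-≤ t (λ _ → 𝟙≤1 (_ <? v))) (≤-reflexive (trans (∑-const t 1) (*-identityʳ t)))

countLess-split : ∀ l {t v} → v ≤ t → (∀ {k} → k < v → at l k ≤ k) →
                  countLess l t v ≡ v + (∑[ k < t ∸ v ] 𝟙 (at l (v + k) <? v))
countLess-split l {t} {v} v≤t bounded = begin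
  countLess l t v               ≡⟨ cong (λ n → countLess l n v) (m+[n∸m]≡n v≤t) ⟨
  countLess l (v + (t ∸ v)) v   ≡⟨ ∑-split v (t ∸ v) _ ⟩
  countLess l v v + Rest        ≡⟨ cong (_+ Rest) all-below ⟩
  v + Rest                      ∎
  where
  Rest = ∑[ k < t ∸ v ] 𝟙 (at l (v + k) <? v)
  all-below : countLess l v v ≡ v
  all-below = trans (∑-cong v (λ k<v → 𝟙-yes (_ <? v) (≤-<-trans (bounded k<v) k<v)))
                    (trans (∑-const v 1) (*-identityʳ v))

-- The first at l t positions always count (a_k ≤ k < a_t), so self-description at t says exactly
-- that no position in [a_t, t) does.
NestedAt⇔self-counting : ∀ l t → (∀ {k} → k < t → at l k ≤ k) →
                         NestedAt l t ⇔ (at l t ≡ countLess l t (at l t))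
NestedAt⇔self-counting l t bounded = mk⇔ split combine
  where
  v = at l t
  Rest = ∑[ k < t ∸ v ] 𝟙 (at l (v + k) <? v)
  bounded-below : v ≤ t → ∀ {k} → k < v → at l k ≤ k
  bounded-below v≤t k<v = bounded (<-≤-trans k<v v≤t)
  split : NestedAt l t → v ≡ countLess l t v
  split (v≤t , v≤a) = sym (begin
    countLess l t v ≡⟨ countLess-split l v≤t (bounded-below v≤t) ⟩
    v + Rest        ≡⟨ cong (v +_) (∑-zero (t ∸ v) none-below) ⟩
    v + 0           ≡⟨ +-identityʳ v ⟩
    v               ∎)
    where
    none-below : ∀ {k} → k < t ∸ v → 𝟙 (at l (v + k) <? v) ≡ 0
    none-below {k} k<t∸v =
      𝟙-no (_ <? v) (≤⇒≯ (v≤a (m≤m+n v k) (≤-trans (+-monoʳ-≤ v (<⇒≤ k<t∸v)) (≤-reflexive (m+[n∸m]≡n v≤t)))))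
  combine : v ≡ countLess l t v → NestedAt l t
  combine v≡count = v≤t , v≤a
    where
    v≤t : v ≤ t
    v≤t = subst (_≤ t) (sym v≡count) (countLess-≤ l t v)
    Rest≡0 : Rest ≡ 0
    Rest≡0 = +-cancelˡ-≡ v Rest 0
               (trans (sym (countLess-split l v≤t (bounded-below v≤t))) (trans (sym v≡count) (sym (+-identityʳ v))))
    v≤a : ∀ {j} → v ≤ j → j ≤ t → v ≤ at l j
    v≤a {j} v≤j j≤t with m≤n⇒m<n∨m≡n j≤t
    ... | inj₂ refl = ≤-refl
    ... | inj₁ j<t  = subst (λ i → v ≤ at l i) (m+[n∸m]≡n v≤j)
                        (≮⇒≥ (𝟙≡0⇒¬ (_ <? v) (∑≡0⇒≡0 (t ∸ v) Rest≡0 (∸-monoˡ-< j<t v≤j))))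

Fin⇒< : ∀ {m} (P : ℕ → Set) → (∀ (i : Fin m) → P (toℕ i)) → ∀ {k} → k < m → P k
Fin⇒< P h k<m = subst P (toℕ-fromℕ< k<m) (h (fromℕ< k<m))

module _ {n} (a : Vec ℕ (suc n)) where

  private
    l = toList a

  countBelow≡countLess : ∀ i → countBelow a i ≡ countLess l (toℕ i) (at l (toℕ i))
  countBelow≡countLess i = begin
    countBelow a i                            ≡⟨ length-filter-tabulate BelowFin? Below? id Below⇔ ⟩
    ∑[ k < suc n ] 𝟙 (Below? k)               ≡⟨ cong (λ m → ∑[ k < m ] 𝟙 (Below? k)) (m+[n∸m]≡n t≤n+1) ⟨
    ∑[ k < t + (suc n ∸ t) ] 𝟙 (Below? k)     ≡⟨ ∑-split t (suc n ∸ t) _ ⟩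
    (∑[ k < t ] 𝟙 (Below? k)) + (∑[ k < suc n ∸ t ] 𝟙 (Below? (t + k)))
      ≡⟨ cong₂ _+_ (∑-cong t (λ k<t → 𝟙-cong (Below? _) (_ <? v) (mk⇔ proj₂ (k<t ,_))))
                   (∑-zero (suc n ∸ t) (λ {k} _ → 𝟙-no (Below? _) (m+n≮m t k ∘ proj₁))) ⟩
    countLess l t v + 0                       ≡⟨ +-identityʳ _ ⟩
    countLess l t v                           ∎
    where
    t = toℕ i
    v = at l t
    t≤n+1 = <⇒≤ (toℕ<n i)
    BelowFin? : Decidable (λ j → j Fin.< i × lookup a j < lookup a i)
    BelowFin? j = (j Fin.<? i) ×-dec (lookup a j <? lookup a i)
    Below? : Decidable (λ k → k < t × at l k < v)
    Below? k = (k <? t) ×-dec (at l k <? v)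
    Below⇔ : ∀ j → (j Fin.< i × lookup a j < lookup a i) ⇔ (toℕ j < t × at l (toℕ j) < v)
    Below⇔ j rewrite at-toList a j | at-toList a i = mk⇔ id id

  SelfDescribingAt⇔ : ∀ i →
    (lookup a i ≡ countBelow a i) ⇔ (at l (toℕ i) ≡ countLess l (toℕ i) (at l (toℕ i)))
  SelfDescribingAt⇔ i rewrite countBelow≡countLess i | at-toList a i = mk⇔ id id

  InA×SelfDescribing⇔Nested : (InA a × SelfDescribing a) ⇔ Nested l
  InA×SelfDescribing⇔Nested = mk⇔ combine split
    where
    <-length : ∀ {k} → k < suc n → k < length l
    <-length = subst (_ <_) (sym (length-toList a))
    split : Nested l → InA a × SelfDescribing a
    split nested = (λ i → subst (_≤ toℕ i) (at-toList a i) (bounded (toℕ<n i)))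
                 , (λ i → from (SelfDescribingAt⇔ i)
                               (to (NestedAt⇔self-counting l (toℕ i) (λ k<t → bounded (<-trans k<t (toℕ<n i))))
                                   (nested (<-length (toℕ<n i)))))
      where
      bounded : ∀ {k} → k < suc n → at l k ≤ k
      bounded k<n+1 = proj₁ (nested (<-length k<n+1))
    combine : InA a × SelfDescribing a → Nested l
    combine (inA , sd) {t} t<len =
      from (NestedAt⇔self-counting l t (λ k<t → bounded (<-trans k<t t<n+1))) (self-counting t<n+1)
      where
      t<n+1 = subst (t <_) (length-toList a) t<len
      bounded : ∀ {k} → k < suc n → at l k ≤ k
      bounded = Fin⇒< (λ k → at l k ≤ k) (λ i → subst (_≤ toℕ i) (sym (at-toList a i)) (inA i))
      self-counting : ∀ {t} → t < suc n → at l t ≡ countLess l t (at l t)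
      self-counting = Fin⇒< (λ t → at l t ≡ countLess l t (at l t)) (λ i → to (SelfDescribingAt⇔ i) (sd i))

theorem4 : (n : ℕ) →
    HasCard {Vec ℕ (suc n)} (λ a → InA a × SelfDescribing a) (catalan (suc n))
    × HasCard {Vec ℕ (suc n)} (CatC n) (catalan (suc n))
    × ((r : ℕ) → r ≤ n →
        HasCard {Vec ℕ (suc n)} (λ a → CatC n a × last a ≡ r) (catalan r * catalan (n ∸ r)))
theorem4 n =
  HasCard-toList InA×SelfDescribing⇔Nested (HasCard-NestedOfLength (suc n)) ,
  HasCard-toList CatC⇔Nested (HasCard-NestedOfLength (suc n)) ,
  λ r r≤n → HasCard-toList (λ a → CatC⇔Nested a ×-⇔ last≡⇔at≡ a)
              (HasCard-NestedEndingIn r≤n (HasCard-NestedOfLength r) (HasCard-NestedOfLength (n ∸ r)))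
  where
  last≡⇔at≡ : ∀ {r} (a : Vec ℕ (suc n)) → last a ≡ r ⇔ at (toList a) n ≡ r
  last≡⇔at≡ a = mk⇔ (trans (at-toList-last a)) (trans (sym (at-toList-last a)))
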